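{- Let $A$ be a finite alphabet and let $F$ be a uniform dill map on $A^{\mathbb N}$ with diameter $\theta$ and local rule $f$. Then for all $\ell,k\in\mathbb N$, setting $m=\lceil k/\|f\|^-\rceil$ and $p=\lfloor (\ell+k)/\|f\|^-\rfloor-(m+1)$, we have for all $x,y\in A^{\mathbb N}$: $$d_H(F(x)_{[k,k+\ell)},F(y)_{[k,k+\ell)})\le d_H(x_{[m,m+p+\theta)},y_{[m,m+p+\theta)})\,\theta\,\Delta_f+2\|f\|^-.$$
   Context: Write $u_{[a,b)}=u_a\cdots u_{b-1}$ (empty if $b\le a$). $d_H(u,v)=|\{i:u_i\ne v_i\}|$ for words of equal length. A dill map with diameter $\theta\ge1$ and local rule $f:A^\theta\to A^+$ is $F(x)=f(x_{[0,\theta)})f(x_{[1,\theta+1)})\cdots$; $\|f\|^-=\min_{u\in A^\theta}|f(u)|$, and $F$ is uniform if all $|f(u)|$, $u\in A^\theta$, are equal. For uniform $F$, $\Delta_f=\max\{d_H(f(u),f(v)):u,v\in A^\theta\}$. -}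

module Defs where

open import Data.Nat using (ℕ; zero; suc; _+_; _*_; _∸_; _⊓_; _⊔_; _/_)
open import Data.Fin using (Fin; toℕ; _≟_)
open import Data.Vec using (Vec; []; _∷_; tabulate; replicate)
open import Data.List using (List; []; _∷_; map; concatMap; foldr; zipWith; sum)
open import Data.List.NonEmpty using (List⁺; _∷_; toList) renaming (length to length⁺)
open import Data.Integer using (ℤ; +_; -[1+_])
open import Relation.Nullary using (yes; no)
open import Relation.Binary.PropositionalEquality using (_≡_)
open import Data.List using (length)
import Data.Fin as Fin

allWords : (n t : ℕ) → List (Vec (Fin n) t)
allWords n zero = [] ∷ []
allWords n (suc t) = concatMap (λ a → map (a ∷_) (allWords n t)) (Data.List.allFin n)

LocalRule : ℕ → ℕ → Set
LocalRule n θ = Vec (Fin n) θ → List⁺ (Fin n)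

window : ∀ {n} (θ : ℕ) → (ℕ → Fin n) → ℕ → Vec (Fin n) θ
window θ x i = tabulate (λ j → x (i + toℕ j))

-- Position j of the infinite concatenation w_i w_{i+1} w_{i+2} ..., where the
-- current block still to be read is the nonempty word given as 3rd argument.
concatAt : ∀ {n} → (ℕ → List⁺ (Fin n)) → ℕ → List⁺ (Fin n) → ℕ → Fin n
concatAt w i (a ∷ rest) zero = a
concatAt w i (a ∷ []) (suc j) = concatAt w (suc i) (w (suc i)) j
concatAt w i (a ∷ (b ∷ rest)) (suc j) = concatAt w i (b ∷ rest) j

dill : ∀ {n} (θ : ℕ) → LocalRule n θ → (ℕ → Fin n) → ℕ → Fin n
dill θ f x = concatAt w 0 (w 0)
  where
  w : ℕ → List⁺ (Fin _)
  w i = f (window θ x i)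

Uniform : ∀ {n θ} → LocalRule n θ → Set
Uniform f = ∀ u v → length⁺ (f u) ≡ length⁺ (f v)

-- Since every |f(u)| = suc (length of the tail of f(u)), we compute
-- ‖f‖⁻ = suc (min_u |tail f(u)|); the fold is seeded with the value at the
-- all-zero word, which is itself in the list, so this is exactly the minimum.
normMinus : ∀ {s θ} → LocalRule (suc s) θ → ℕ
normMinus {s} {θ} f =
  suc (foldr _⊓_ (tl (f (replicate θ Fin.zero))) (map (λ u → tl (f u)) (allWords (suc s) θ)))
  where
  tl : List⁺ (Fin (suc s)) → ℕ
  tl (a ∷ r) = length r

-- Hamming distance of two words (counting mismatches position by position;
-- used only for words of equal length).
dH : ∀ {n} → List (Fin n) → List (Fin n) → ℕ
dH [] _ = 0
dH (_ ∷ _) [] = 0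
dH (a ∷ u) (b ∷ v) with a ≟ b
... | yes _ = dH u v
... | no _ = suc (dH u v)

Delta : ∀ {n θ} → LocalRule n θ → ℕ
Delta {n} {θ} f =
  foldr _⊔_ 0 (concatMap (λ u → map (λ v → dH (toList (f u)) (toList (f v))) (allWords n θ)) (allWords n θ))

factor : ∀ {n} → (ℕ → Fin n) → ℕ → ℕ → List (Fin n)
factor x a b = Data.List.map (λ i → x (a + i)) (Data.List.upTo (b ∸ a))

-- Clamp an integer to ℕ (negative ↦ 0); used for an integer right endpoint b,
-- so that x_{[a,b)} is empty whenever b ≤ a.
clamp : ℤ → ℕ
clamp (+ n) = n
clamp -[1+ _ ] = 0

ceilDiv : ℕ → (L : ℕ) → .{{_ : Data.Nat.NonZero L}} → ℕ
ceilDiv k L = (k + (L ∸ 1)) / L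

-- For uniform F with block length L, F(x) is the concatenation of the blocks f(x_{[j,j+θ)}),
-- the j-th occupying positions [jL, jL + L).  Cut [k, k + ℓ) at the block boundaries mL and
-- qL (q = ⌊(ℓ+k)/L⌋); the two margins are shorter than L, and each of the q - m = p + 1
-- whole blocks in between differs in at most Δ_f places, and only if its window meets a
-- mismatch of x and y in [m, m + p + θ).  A mismatch lies in at most θ windows, so the
-- middle contributes at most θ Δ_f d_H(x_{[m,m+p+θ)}, y_{[m,m+p+θ)}).  When q ≤ m there is
-- no whole block and ℓ < 2L already.
module Submission where

open import Defs
open import Data.Nat using (ℕ; zero; suc; _+_; _*_; _∸_; _≤_; _<_; _/_; _%_; _⊔_; _⊓_; NonZero; z≤n; s≤s; s≤s⁻¹; _≤?_)
open import Data.Nat.Properties hiding (_≟_)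
open import Algebra.Properties.CommutativeSemigroup +-commutativeSemigroup using (interchange)
open import Data.Nat.DivMod using (m≡m%n+[m/n]*n; m%n<n; m/n*n≤m)
open import Data.Fin using (Fin; toℕ; _≟_)
open import Data.Fin.Properties using (toℕ<n)
open import Data.Vec using (Vec; []; _∷_)
open import Data.Vec.Properties using (tabulate-cong)
open import Data.List using (List; []; _∷_; map; foldr; applyUpTo; upTo; length)
open import Data.List.Properties using (map-applyUpTo; map-cong)
open import Data.List.NonEmpty using (List⁺; _∷_; toList; tail) renaming (length to length⁺)
open import Data.List.Relation.Unary.Any as Any using (here; there)
open import Data.List.Membership.Propositional using (_∈_)
open import Data.List.Membership.Propositional.Properties using (∈-map⁺; ∈-concatMap⁺; ∈-allFin)
open import Data.Integer using (+_) renaming (_+_ to _+ℤ_; _-_ to _-ℤ_)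
open import Data.Integer.Properties using (m-n≡m⊖n; ⊖-≥)
open import Data.Empty using (⊥-elim)
open import Relation.Nullary using (yes; no)
open import Relation.Binary.PropositionalEquality

∑ : ℕ → (ℕ → ℕ) → ℕ
∑ zero    g = 0
∑ (suc n) g = g 0 + ∑ n (λ i → g (suc i))

syntax ∑ n (λ i → e) = ∑[ i < n ] e

∑-cong : ∀ n {g h} → (∀ i → i < n → g i ≡ h i) → ∑ n g ≡ ∑ n h
∑-cong zero    eq = refl
∑-cong (suc n) eq = cong₂ _+_ (eq 0 (s≤s z≤n)) (∑-cong n (λ i i<n → eq (suc i) (s≤s i<n)))

∑-mono-≤ : ∀ n {g h} → (∀ i → i < n → g i ≤ h i) → ∑ n g ≤ ∑ n h
∑-mono-≤ zero    le = z≤n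
∑-mono-≤ (suc n) le = +-mono-≤ (le 0 (s≤s z≤n)) (∑-mono-≤ n (λ i i<n → le (suc i) (s≤s i<n)))

∑≤n*c : ∀ n {g} c → (∀ i → i < n → g i ≤ c) → ∑ n g ≤ n * c
∑≤n*c zero    c le = z≤n
∑≤n*c (suc n) c le = +-mono-≤ (le 0 (s≤s z≤n)) (∑≤n*c n c (λ i i<n → le (suc i) (s≤s i<n)))

∑≡0⇒≡0 : ∀ n {g} → ∑ n g ≡ 0 → ∀ i → i < n → g i ≡ 0
∑≡0⇒≡0 (suc n) {g} eq zero    _         = m+n≡0⇒m≡0 (g 0) eq
∑≡0⇒≡0 (suc n) {g} eq (suc i) (s≤s i<n) = ∑≡0⇒≡0 n (m+n≡0⇒n≡0 (g 0) eq) i i<n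

∑-++ : ∀ m n g → ∑ (m + n) g ≡ ∑ m g + ∑[ i < n ] g (m + i)
∑-++ zero    n g = refl
∑-++ (suc m) n g = trans (cong (_+_ (g 0)) (∑-++ m n (λ i → g (suc i)))) (sym (+-assoc (g 0) _ _))

∑-monoˡ-≤ : ∀ g {m n} → m ≤ n → ∑ m g ≤ ∑ n g
∑-monoˡ-≤ g {m} {n} m≤n = begin
  ∑ m g                                 ≤⟨ m≤m+n (∑ m g) _ ⟩
  ∑ m g + ∑[ i < n ∸ m ] g (m + i)      ≡⟨ ∑-++ m (n ∸ m) g ⟨
  ∑ (m + (n ∸ m)) g                     ≡⟨ cong (λ d → ∑ d g) (m+[n∸m]≡n m≤n) ⟩
  ∑ n g                                 ∎
  where open ≤-Reasoning

∑-zero : ∀ n → ∑[ i < n ] 0 ≡ 0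
∑-zero zero    = refl
∑-zero (suc n) = ∑-zero n

∑-distrib-+ : ∀ n g h → ∑[ i < n ] (g i + h i) ≡ ∑ n g + ∑ n h
∑-distrib-+ zero    g h = refl
∑-distrib-+ (suc n) g h = trans (cong (_+_ (g 0 + h 0)) (∑-distrib-+ n (λ i → g (suc i)) (λ i → h (suc i))))
                                (interchange (g 0) (h 0) _ _)

∑-distribʳ-* : ∀ n g c → ∑[ i < n ] (g i * c) ≡ ∑ n g * c
∑-distribʳ-* zero    g c = refl
∑-distribʳ-* (suc n) g c = trans (cong (_+_ (g 0 * c)) (∑-distribʳ-* n (λ i → g (suc i)) c))
                                 (sym (*-distribʳ-+ c (g 0) _))

∑-comm : ∀ m n (g : ℕ → ℕ → ℕ) → ∑[ i < m ] ∑[ j < n ] g i j ≡ ∑[ j < n ] ∑[ i < m ] g i j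
∑-comm zero    n g = sym (∑-zero n)
∑-comm (suc m) n g = trans (cong (_+_ (∑[ j < n ] g 0 j)) (∑-comm m n (λ i → g (suc i))))
                           (sym (∑-distrib-+ n (g 0) (λ j → ∑[ i < m ] g (suc i) j)))

∑-blocks : ∀ N L g → ∑ (N * L) g ≡ ∑[ b < N ] ∑[ r < L ] g (b * L + r)
∑-blocks zero    L g = refl
∑-blocks (suc N) L g = begin
  ∑ (L + N * L) g                                        ≡⟨ ∑-++ L (N * L) g ⟩
  ∑ L g + ∑[ i < N * L ] g (L + i)                       ≡⟨ cong (_+_ (∑ L g)) (∑-blocks N L (λ i → g (L + i))) ⟩
  ∑ L g + ∑[ b < N ] ∑[ r < L ] g (L + (b * L + r))      ≡⟨ cong (_+_ (∑ L g)) (∑-cong N (λ b _ →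
                                                              ∑-cong L (λ r _ → cong g (sym (+-assoc L (b * L) r))))) ⟩
  ∑ L g + ∑[ b < N ] ∑[ r < L ] g (suc b * L + r)        ∎
  where open ≡-Reasoning

-- Every g j with j < P + θ occurs at most θ times on the left.
∑-sliding-window : ∀ P θ g → ∑[ b < suc P ] ∑[ i < θ ] g (b + i) ≤ θ * ∑ (P + θ) g
∑-sliding-window P θ g = begin
  ∑[ b < suc P ] ∑[ i < θ ] g (b + i)     ≡⟨ ∑-comm (suc P) θ (λ b i → g (b + i)) ⟩
  ∑[ i < θ ] ∑[ b < suc P ] g (b + i)     ≤⟨ ∑≤n*c θ (∑ (P + θ) g) window-in-range ⟩
  θ * ∑ (P + θ) g                         ∎
  where
  open ≤-Reasoning
  window-in-range : ∀ i → i < θ → ∑[ b < suc P ] g (b + i) ≤ ∑ (P + θ) g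
  window-in-range i i<θ = begin
    ∑[ b < suc P ] g (b + i)              ≡⟨ ∑-cong (suc P) (λ b _ → cong g (+-comm b i)) ⟩
    ∑[ b < suc P ] g (i + b)              ≤⟨ m≤n+m _ (∑ i g) ⟩
    ∑ i g + ∑[ b < suc P ] g (i + b)      ≡⟨ ∑-++ i (suc P) g ⟨
    ∑ (i + suc P) g                       ≤⟨ ∑-monoˡ-≤ g (begin
                                               i + suc P ≡⟨ +-suc i P ⟩
                                               suc i + P ≤⟨ +-monoˡ-≤ P i<θ ⟩
                                               θ + P     ≡⟨ +-comm θ P ⟩
                                               P + θ     ∎) ⟩
    ∑ (P + θ) g                           ∎

mismatch : ∀ {n} → Fin n → Fin n → ℕ
mismatch a b with a ≟ b
... | yes _ = 0
... | no  _ = 1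

mismatch≤1 : ∀ {n} (a b : Fin n) → mismatch a b ≤ 1
mismatch≤1 a b with a ≟ b
... | yes _ = z≤n
... | no  _ = s≤s z≤n

mismatch≡0⇒≡ : ∀ {n} {a b : Fin n} → mismatch a b ≡ 0 → a ≡ b
mismatch≡0⇒≡ {a = a} {b} eq with a ≟ b
... | yes a≡b = a≡b

dH-∷ : ∀ {n} (a b : Fin n) u v → dH (a ∷ u) (b ∷ v) ≡ mismatch a b + dH u v
dH-∷ a b u v with a ≟ b
... | yes _ = refl
... | no  _ = refl

dH-refl : ∀ {n} (u : List (Fin n)) → dH u u ≡ 0
dH-refl []      = refl
dH-refl (a ∷ u) with a ≟ a
... | yes _   = dH-refl u
... | no  a≢a = ⊥-elim (a≢a refl)

dH-applyUpTo : ∀ {n} (g h : ℕ → Fin n) m → dH (applyUpTo g m) (applyUpTo h m) ≡ ∑[ i < m ] mismatch (g i) (h i)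
dH-applyUpTo g h zero    = refl
dH-applyUpTo g h (suc m) = trans (dH-∷ (g 0) (h 0) _ _)
  (cong (_+_ (mismatch (g 0) (h 0))) (dH-applyUpTo (λ i → g (suc i)) (λ i → h (suc i)) m))

mismatches : ∀ {n} → (ℕ → Fin n) → (ℕ → Fin n) → ℕ → ℕ → ℕ
mismatches z z′ a b = ∑[ i < b ∸ a ] mismatch (z (a + i)) (z′ (a + i))

dH-factor : ∀ {n} (z z′ : ℕ → Fin n) a b → dH (factor z a b) (factor z′ a b) ≡ mismatches z z′ a b
dH-factor z z′ a b
  rewrite map-applyUpTo (λ i → i) (λ i → z (a + i)) (b ∸ a)
        | map-applyUpTo (λ i → i) (λ i → z′ (a + i)) (b ∸ a)
  = dH-applyUpTo (λ i → z (a + i)) (λ i → z′ (a + i)) (b ∸ a)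

mismatches-+ : ∀ {n} (z z′ : ℕ → Fin n) a d → mismatches z z′ a (a + d) ≡ ∑[ i < d ] mismatch (z (a + i)) (z′ (a + i))
mismatches-+ z z′ a d = cong (λ e → ∑[ i < e ] mismatch (z (a + i)) (z′ (a + i))) (m+n∸m≡n a d)

mismatches≤∸ : ∀ {n} (z z′ : ℕ → Fin n) a b → mismatches z z′ a b ≤ b ∸ a
mismatches≤∸ z z′ a b = ≤-trans (∑≤n*c (b ∸ a) 1 (λ i _ → mismatch≤1 _ _)) (≤-reflexive (*-identityʳ (b ∸ a)))

mismatches-split : ∀ {n} (z z′ : ℕ → Fin n) {a b c} → a ≤ b → b ≤ c →
  mismatches z z′ a c ≡ mismatches z z′ a b + mismatches z z′ b c
mismatches-split z z′ {a} {b} {c} a≤b b≤c = begin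
  ∑[ i < c ∸ a ] G i                              ≡⟨ cong (λ d → ∑ d G) c∸a ⟩
  ∑[ i < (b ∸ a) + (c ∸ b) ] G i                  ≡⟨ ∑-++ (b ∸ a) (c ∸ b) G ⟩
  ∑[ i < b ∸ a ] G i + ∑[ i < c ∸ b ] G (b ∸ a + i)
    ≡⟨ cong (_+_ (mismatches z z′ a b)) (∑-cong (c ∸ b) (λ i _ → cong (λ j → mismatch (z j) (z′ j)) (shift i))) ⟩
  mismatches z z′ a b + mismatches z z′ b c       ∎
  where
  open ≡-Reasoning
  G : ℕ → ℕ
  G i = mismatch (z (a + i)) (z′ (a + i))
  shift : ∀ i → a + (b ∸ a + i) ≡ b + i
  shift i = trans (sym (+-assoc a (b ∸ a) i)) (cong (_+ i) (m+[n∸m]≡n a≤b))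
  c∸a : c ∸ a ≡ (b ∸ a) + (c ∸ b)
  c∸a = +-cancelˡ-≡ a _ _ (begin
    a + (c ∸ a)             ≡⟨ m+[n∸m]≡n (≤-trans a≤b b≤c) ⟩
    c                       ≡⟨ m+[n∸m]≡n b≤c ⟨
    b + (c ∸ b)             ≡⟨ cong (_+ (c ∸ b)) (m+[n∸m]≡n a≤b) ⟨
    a + (b ∸ a) + (c ∸ b)   ≡⟨ +-assoc a (b ∸ a) (c ∸ b) ⟩
    a + ((b ∸ a) + (c ∸ b)) ∎)

mismatches≤margins+middle : ∀ {n} (z z′ : ℕ → Fin n) {a b c d} → a ≤ b → b ≤ c → c ≤ d →
  mismatches z z′ a d ≤ (b ∸ a) + (mismatches z z′ b c + (d ∸ c))
mismatches≤margins+middle z z′ {a} {b} {c} {d} a≤b b≤c c≤d = begin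
  mismatches z z′ a d
    ≡⟨ mismatches-split z z′ a≤b (≤-trans b≤c c≤d) ⟩
  mismatches z z′ a b + mismatches z z′ b d
    ≡⟨ cong (_+_ (mismatches z z′ a b)) (mismatches-split z z′ b≤c c≤d) ⟩
  mismatches z z′ a b + (mismatches z z′ b c + mismatches z z′ c d)
    ≤⟨ +-mono-≤ (mismatches≤∸ z z′ a b) (+-monoʳ-≤ (mismatches z z′ b c) (mismatches≤∸ z z′ c d)) ⟩
  (b ∸ a) + (mismatches z z′ b c + (d ∸ c))                      ∎
  where open ≤-Reasoning

applyUpTo-concatAt : ∀ {n} (W : ℕ → List⁺ (Fin n)) i u → applyUpTo (concatAt W i u) (length⁺ u) ≡ toList u
applyUpTo-concatAt W i (a ∷ r) = go a r
  where
  go : ∀ a r → applyUpTo (concatAt W i (a ∷ r)) (suc (length r)) ≡ a ∷ r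
  go a []      = refl
  go a (b ∷ r) = cong (a ∷_) (go b r)

concatAt-skip : ∀ {n} (W : ℕ → List⁺ (Fin n)) i u j → concatAt W i u (length⁺ u + j) ≡ concatAt W (suc i) (W (suc i)) j
concatAt-skip W i (a ∷ r) j = go a r
  where
  go : ∀ a r → concatAt W i (a ∷ r) (suc (length r) + j) ≡ concatAt W (suc i) (W (suc i)) j
  go a []      = refl
  go a (b ∷ r) = go b r

concatAt-uniform : ∀ {n L} (W : ℕ → List⁺ (Fin n)) → (∀ i → length⁺ (W i) ≡ L) →
  ∀ i j r → concatAt W i (W i) (j * L + r) ≡ concatAt W (i + j) (W (i + j)) r
concatAt-uniform W len i zero    r = cong (λ i′ → concatAt W i′ (W i′) r) (sym (+-identityʳ i))
concatAt-uniform {L = L} W len i (suc j) r = begin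
  concatAt W i (W i) (L + j * L + r)               ≡⟨ cong (concatAt W i (W i)) (+-assoc L (j * L) r) ⟩
  concatAt W i (W i) (L + (j * L + r))             ≡⟨ cong (λ l → concatAt W i (W i) (l + (j * L + r))) (len i) ⟨
  concatAt W i (W i) (length⁺ (W i) + (j * L + r)) ≡⟨ concatAt-skip W i (W i) (j * L + r) ⟩
  concatAt W (suc i) (W (suc i)) (j * L + r)       ≡⟨ concatAt-uniform W len (suc i) j r ⟩
  concatAt W (suc i + j) (W (suc i + j)) r         ≡⟨ cong (λ i′ → concatAt W i′ (W i′) r) (+-suc i j) ⟨
  concatAt W (i + suc j) (W (i + suc j)) r         ∎
  where open ≡-Reasoning

dill-block : ∀ {n θ L} (f : LocalRule n θ) → (∀ u → length⁺ (f u) ≡ L) → ∀ x j →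
  factor (dill θ f x) (j * L) (j * L + L) ≡ toList (f (window θ x j))
dill-block {θ = θ} {L} f len x j = begin
  map Fx (upTo (j * L + L ∸ j * L))               ≡⟨ cong (λ d → map Fx (upTo d)) (m+n∸m≡n (j * L) L) ⟩
  map Fx (upTo L)                                 ≡⟨ map-cong (concatAt-uniform W (λ i → len (window θ x i)) 0 j) (upTo L) ⟩
  map (concatAt W j (W j)) (upTo L)               ≡⟨ map-applyUpTo (λ r → r) (concatAt W j (W j)) L ⟩
  applyUpTo (concatAt W j (W j)) L                ≡⟨ cong (applyUpTo (concatAt W j (W j))) (len (window θ x j)) ⟨
  applyUpTo (concatAt W j (W j)) (length⁺ (W j)) ≡⟨ applyUpTo-concatAt W j (W j) ⟩
  toList (f (window θ x j))                       ∎
  where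
  open ≡-Reasoning
  W : ℕ → List⁺ _
  W i = f (window θ x i)
  Fx : ℕ → Fin _
  Fx r = dill θ f x (j * L + r)

allWords-complete : ∀ n t (u : Vec (Fin n) t) → u ∈ allWords n t
allWords-complete n zero    []      = here refl
allWords-complete n (suc t) (a ∷ u) = ∈-concatMap⁺ (λ b → map (b ∷_) (allWords n t))
  (Any.map (λ { refl → ∈-map⁺ (a ∷_) (allWords-complete n t u) }) (∈-allFin a))

∈⇒≤foldr-⊔ : ∀ {v : ℕ} {vs} → v ∈ vs → v ≤ foldr _⊔_ 0 vs
∈⇒≤foldr-⊔ {vs = w ∷ ws} (here refl) = m≤m⊔n w _
∈⇒≤foldr-⊔ {vs = w ∷ ws} (there v∈) = ≤-trans (∈⇒≤foldr-⊔ v∈) (m≤n⊔m w _)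

dH≤Delta : ∀ {n θ} (f : LocalRule n θ) u v → dH (toList (f u)) (toList (f v)) ≤ Delta f
dH≤Delta {n} {θ} f u v = ∈⇒≤foldr-⊔ (∈-concatMap⁺ _
  (Any.map (λ { refl → ∈-map⁺ (λ v′ → dH (toList (f u)) (toList (f v′))) (allWords-complete n θ v) })
           (allWords-complete n θ u)))

foldr-⊓-map-const : ∀ {A : Set} (g : A → ℕ) c xs → (∀ u → g u ≡ c) → foldr _⊓_ c (map g xs) ≡ c
foldr-⊓-map-const g c []       eq = refl
foldr-⊓-map-const g c (x ∷ xs) eq rewrite foldr-⊓-map-const g c xs eq | eq x = ⊓-idem c

length≡normMinus : ∀ {s θ} (f : LocalRule (suc s) θ) → Uniform f → ∀ u → length⁺ (f u) ≡ normMinus f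
length≡normMinus {s} {θ} f uniform u = trans (uniform u _) (cong suc (sym
  (foldr-⊓-map-const (λ v → length (tail (f v))) _ (allWords (suc s) θ) (λ v → suc-injective (uniform v _)))))

window-cong : ∀ {n} θ (x y : ℕ → Fin n) j → mismatches x y j (j + θ) ≡ 0 → window θ x j ≡ window θ y j
window-cong θ x y j eq = tabulate-cong (λ i →
  mismatch≡0⇒≡ (∑≡0⇒≡0 θ (trans (sym (mismatches-+ x y j θ)) eq) (toℕ i) (toℕ<n i)))

dH-local-rule≤ : ∀ {n θ} (f : LocalRule n θ) x y j →
  dH (toList (f (window θ x j))) (toList (f (window θ y j))) ≤ mismatches x y j (j + θ) * Delta f
dH-local-rule≤ {θ = θ} f x y j with mismatches x y j (j + θ) in eq
... | zero  = ≤-reflexive (trans (cong (λ w → dH (toList (f w)) (toList (f (window θ y j)))) (window-cong θ x y j eq))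
                                 (dH-refl (toList (f (window θ y j)))))
... | suc d = ≤-trans (dH≤Delta f _ _) (m≤n*m (Delta f) (suc d))

dill-mismatches-aligned : ∀ {n θ L} (f : LocalRule n θ) → (∀ u → length⁺ (f u) ≡ L) → ∀ x y m P →
  mismatches (dill θ f x) (dill θ f y) (m * L) ((m + suc P) * L) ≤ mismatches x y m (m + P + θ) * θ * Delta f
dill-mismatches-aligned {θ = θ} {L} f len x y m P = begin
  mismatches Fx Fy (m * L) ((m + suc P) * L)                 ≡⟨ cong (mismatches Fx Fy (m * L)) (*-distribʳ-+ L m (suc P)) ⟩
  mismatches Fx Fy (m * L) (m * L + suc P * L)               ≡⟨ mismatches-+ Fx Fy (m * L) (suc P * L) ⟩
  ∑[ i < suc P * L ] cF (m * L + i)                          ≡⟨ ∑-blocks (suc P) L (λ i → cF (m * L + i)) ⟩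
  ∑[ b < suc P ] ∑[ r < L ] cF (m * L + (b * L + r))         ≡⟨ ∑-cong (suc P) (λ b _ → block b) ⟩
  ∑[ b < suc P ] dH (toList (f (window θ x (m + b)))) (toList (f (window θ y (m + b))))
    ≤⟨ ∑-mono-≤ (suc P) (λ b _ → dH-local-rule≤ f x y (m + b)) ⟩
  ∑[ b < suc P ] (mismatches x y (m + b) (m + b + θ) * Δ)    ≡⟨ ∑-distribʳ-* (suc P) (λ b → mismatches x y (m + b) (m + b + θ)) Δ ⟩
  ∑[ b < suc P ] mismatches x y (m + b) (m + b + θ) * Δ      ≡⟨ cong (_* Δ) (∑-cong (suc P) (λ b _ → window-sum b)) ⟩
  ∑[ b < suc P ] ∑[ i < θ ] c (b + i) * Δ                    ≤⟨ *-monoˡ-≤ Δ (∑-sliding-window P θ c) ⟩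
  θ * ∑ (P + θ) c * Δ                                        ≡⟨ cong (_* Δ) (*-comm θ (∑ (P + θ) c)) ⟩
  ∑ (P + θ) c * θ * Δ                                        ≡⟨ cong (λ e → e * θ * Δ) (trans
                                                                  (sym (mismatches-+ x y m (P + θ)))
                                                                  (cong (mismatches x y m) (sym (+-assoc m P θ)))) ⟩
  mismatches x y m (m + P + θ) * θ * Δ                       ∎
  where
  open ≤-Reasoning
  Fx = dill θ f x
  Fy = dill θ f y
  Δ = Delta f
  cF : ℕ → ℕ
  cF i = mismatch (Fx i) (Fy i)
  c : ℕ → ℕ
  c i = mismatch (x (m + i)) (y (m + i))
  block : ∀ b → ∑[ r < L ] cF (m * L + (b * L + r)) ≡ dH (toList (f (window θ x (m + b)))) (toList (f (window θ y (m + b))))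
  block b = begin-equality
    ∑[ r < L ] cF (m * L + (b * L + r))          ≡⟨ ∑-cong L (λ r _ → cong cF (trans (sym (+-assoc (m * L) (b * L) r))
                                                                            (cong (_+ r) (sym (*-distribʳ-+ L m b))))) ⟩
    ∑[ r < L ] cF ((m + b) * L + r)              ≡⟨ mismatches-+ Fx Fy ((m + b) * L) L ⟨
    mismatches Fx Fy ((m + b) * L) ((m + b) * L + L)
                                                 ≡⟨ dH-factor Fx Fy ((m + b) * L) ((m + b) * L + L) ⟨
    dH (factor Fx ((m + b) * L) ((m + b) * L + L)) (factor Fy ((m + b) * L) ((m + b) * L + L))
                                                 ≡⟨ cong₂ dH (dill-block f len x (m + b)) (dill-block f len y (m + b)) ⟩
    dH (toList (f (window θ x (m + b)))) (toList (f (window θ y (m + b)))) ∎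
  window-sum : ∀ b → mismatches x y (m + b) (m + b + θ) ≡ ∑[ i < θ ] c (b + i)
  window-sum b = trans (mismatches-+ x y (m + b) θ)
                       (∑-cong θ (λ i _ → cong (λ j → mismatch (x j) (y j)) (+-assoc m b i)))

m≤m/n*n+[n∸1] : ∀ m n .{{_ : NonZero n}} → m ≤ m / n * n + (n ∸ 1)
m≤m/n*n+[n∸1] m n@(suc t) = begin
  m                 ≡⟨ m≡m%n+[m/n]*n m n ⟩
  m % n + m / n * n ≤⟨ +-monoˡ-≤ (m / n * n) (s≤s⁻¹ (m%n<n m n)) ⟩
  t + m / n * n     ≡⟨ +-comm t (m / n * n) ⟩
  m / n * n + t     ∎
  where open ≤-Reasoning

m≤⌈m/n⌉*n : ∀ m n .{{_ : NonZero n}} → m ≤ ceilDiv m n * n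
m≤⌈m/n⌉*n m n = +-cancelʳ-≤ (n ∸ 1) m _ (m≤m/n*n+[n∸1] (m + (n ∸ 1)) n)

⌈m/n⌉*n≤m+[n∸1] : ∀ m n .{{_ : NonZero n}} → ceilDiv m n * n ≤ m + (n ∸ 1)
⌈m/n⌉*n≤m+[n∸1] m n = m/n*n≤m (m + (n ∸ 1)) n

[n∸1]+[n∸1]≤2*n : ∀ n → (n ∸ 1) + (n ∸ 1) ≤ 2 * n
[n∸1]+[n∸1]≤2*n n = +-mono-≤ (m∸n≤m n 1) (≤-trans (m∸n≤m n 1) (m≤m+n n 0))

[m+n]/o≤⌈n/o⌉⇒m≤2*o : ∀ m n o .{{_ : NonZero o}} → (m + n) / o ≤ ceilDiv n o → m ≤ 2 * o
[m+n]/o≤⌈n/o⌉⇒m≤2*o m n o q≤c = ≤-trans (+-cancelʳ-≤ n m _ (begin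
  m + n                                 ≤⟨ m≤m/n*n+[n∸1] (m + n) o ⟩
  (m + n) / o * o + (o ∸ 1)             ≤⟨ +-monoˡ-≤ (o ∸ 1) (*-monoˡ-≤ o q≤c) ⟩
  ceilDiv n o * o + (o ∸ 1)             ≤⟨ +-monoˡ-≤ (o ∸ 1) (⌈m/n⌉*n≤m+[n∸1] n o) ⟩
  n + (o ∸ 1) + (o ∸ 1)                 ≡⟨ +-assoc n (o ∸ 1) (o ∸ 1) ⟩
  n + ((o ∸ 1) + (o ∸ 1))               ≡⟨ +-comm n _ ⟩
  (o ∸ 1) + (o ∸ 1) + n                 ∎)) ([n∸1]+[n∸1]≤2*n o)
  where open ≤-Reasoning

m<n⇒m+1≤n : ∀ {m n} → m < n → m + 1 ≤ n
m<n⇒m+1≤n {m} m<n = ≤-trans (≤-reflexive (+-comm m 1)) m<n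

clamp-endpoint : ∀ m q θ → m < q → clamp ((+ m) +ℤ ((+ q) -ℤ (+ (m + 1))) +ℤ (+ θ)) ≡ m + (q ∸ (m + 1)) + θ
clamp-endpoint m q θ m<q =
  cong (λ p → clamp ((+ m) +ℤ p +ℤ (+ θ))) (trans (m-n≡m⊖n q (m + 1)) (⊖-≥ (m<n⇒m+1≤n m<q)))

dill-mismatches-long : ∀ {n θ L} .{{_ : NonZero L}} (f : LocalRule n θ) → (∀ u → length⁺ (f u) ≡ L) →
  ∀ x y ℓ k → let m = ceilDiv k L; q = (ℓ + k) / L in m < q →
  mismatches (dill θ f x) (dill θ f y) k (k + ℓ) ≤ mismatches x y m (m + (q ∸ (m + 1)) + θ) * θ * Delta f + 2 * L
dill-mismatches-long {θ = θ} {L} f len x y ℓ k m<q = begin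
  mismatches Fx Fy k (k + ℓ)
    ≤⟨ mismatches≤margins+middle Fx Fy (m≤⌈m/n⌉*n k L) (*-monoˡ-≤ L m≤q) q*L≤k+ℓ ⟩
  (m * L ∸ k) + (mismatches Fx Fy (m * L) (q * L) + (k + ℓ ∸ q * L))
    ≤⟨ +-mono-≤ left-margin (+-mono-≤ middle right-margin) ⟩
  (L ∸ 1) + (Y + (L ∸ 1))                ≡⟨ +-comm (L ∸ 1) _ ⟩
  Y + (L ∸ 1) + (L ∸ 1)                  ≡⟨ +-assoc Y (L ∸ 1) (L ∸ 1) ⟩
  Y + ((L ∸ 1) + (L ∸ 1))                ≤⟨ +-monoʳ-≤ Y ([n∸1]+[n∸1]≤2*n L) ⟩
  Y + 2 * L                              ∎
  where
  open ≤-Reasoning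
  Fx = dill θ f x
  Fy = dill θ f y
  m = ceilDiv k L
  q = (ℓ + k) / L
  P = q ∸ (m + 1)
  Y = mismatches x y m (m + P + θ) * θ * Delta f
  m≤q : m ≤ q
  m≤q = <⇒≤ m<q
  q≡m+suc[P] : q ≡ m + suc P
  q≡m+suc[P] = trans (sym (m+[n∸m]≡n (m<n⇒m+1≤n m<q))) (+-assoc m 1 P)
  left-margin : m * L ∸ k ≤ L ∸ 1
  left-margin = m≤n+o⇒m∸n≤o (m * L) k (⌈m/n⌉*n≤m+[n∸1] k L)
  right-margin : k + ℓ ∸ q * L ≤ L ∸ 1
  right-margin = m≤n+o⇒m∸n≤o (k + ℓ) (q * L)
    (≤-trans (≤-reflexive (+-comm k ℓ)) (m≤m/n*n+[n∸1] (ℓ + k) L))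
  q*L≤k+ℓ : q * L ≤ k + ℓ
  q*L≤k+ℓ = ≤-trans (m/n*n≤m (ℓ + k) L) (≤-reflexive (+-comm ℓ k))
  middle : mismatches Fx Fy (m * L) (q * L) ≤ Y
  middle = subst (λ q′ → mismatches Fx Fy (m * L) (q′ * L) ≤ Y) (sym q≡m+suc[P])
                 (dill-mismatches-aligned f len x y m P)

dill-mismatches≤ : ∀ {n θ L} .{{_ : NonZero L}} (f : LocalRule n θ) → (∀ u → length⁺ (f u) ≡ L) → ∀ x y ℓ k →
  let m = ceilDiv k L
      e = clamp ((+ m) +ℤ ((+ ((ℓ + k) / L)) -ℤ (+ (m + 1))) +ℤ (+ θ))
  in  mismatches (dill θ f x) (dill θ f y) k (k + ℓ) ≤ mismatches x y m e * θ * Delta f + 2 * L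
dill-mismatches≤ {θ = θ} {L} f len x y ℓ k with (ℓ + k) / L ≤? ceilDiv k L
... | no  q≰m rewrite clamp-endpoint (ceilDiv k L) ((ℓ + k) / L) θ (≰⇒> q≰m) =
  dill-mismatches-long f len x y ℓ k (≰⇒> q≰m)
... | yes q≤m = begin
  mismatches (dill θ f x) (dill θ f y) k (k + ℓ) ≤⟨ mismatches≤∸ (dill θ f x) (dill θ f y) k (k + ℓ) ⟩
  k + ℓ ∸ k                                      ≡⟨ m+n∸m≡n k ℓ ⟩
  ℓ                                              ≤⟨ [m+n]/o≤⌈n/o⌉⇒m≤2*o ℓ k L q≤m ⟩
  2 * L                                          ≤⟨ m≤n+m (2 * L) Y ⟩
  Y + 2 * L                                      ∎
  where
  open ≤-Reasoning
  m = ceilDiv k L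
  Y = mismatches x y m (clamp ((+ m) +ℤ ((+ ((ℓ + k) / L)) -ℤ (+ (m + 1))) +ℤ (+ θ))) * θ * Delta f

lemma1 : (s θ : ℕ) → 1 ≤ θ → (f : LocalRule (suc s) θ) → Uniform f →
    (ℓ k : ℕ) → (x y : ℕ → Fin (suc s)) →
    let L = normMinus f
        m = ceilDiv k L
        p = (+ ((ℓ + k) / L)) -ℤ (+ (m + 1))
        e = clamp ((+ m) +ℤ p +ℤ (+ θ))
    in dH (factor (dill θ f x) k (k + ℓ)) (factor (dill θ f y) k (k + ℓ))
       ≤ dH (factor x m e) (factor y m e) * θ * Delta f + 2 * L
lemma1 s θ _ f uniform ℓ k x y =
  subst₂ _≤_ (sym (dH-factor (dill θ f x) (dill θ f y) k (k + ℓ)))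
             (cong (λ d → d * θ * Delta f + 2 * L) (sym (dH-factor x y m e)))
             (dill-mismatches≤ f (length≡normMinus f uniform) x y ℓ k)
  where
  L = normMinus f
  m = ceilDiv k L
  e = clamp ((+ m) +ℤ ((+ ((ℓ + k) / L)) -ℤ (+ (m + 1))) +ℤ (+ θ))
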